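{- The formula $\varphi=\neg\neg\Diamond\Box p\to\Diamond\neg\neg\Box p$ (where $p$ is a propositional variable) is not valid over the class of persistent models.
   Context: Formulas: $\varphi::= p\mid\bot\mid\varphi\wedge\varphi\mid\varphi\vee\varphi\mid\varphi\to\varphi\mid\bigcirc\varphi\mid\Diamond\varphi\mid\Box\varphi$; $\neg\varphi:=\varphi\to\bot$. A model is $(W,\preccurlyeq,S,V)$ with $W\ne\emptyset$, $\preccurlyeq$ a partial order, $S\colon W\to W$ forward confluent ($w\preccurlyeq v\Rightarrow S(w)\preccurlyeq S(v)$), and $V\colon W\to2^{\mathbb P}$ monotone ($w\preccurlyeq v\Rightarrow V(w)\subseteq V(v)$). It is persistent if moreover $S$ is backward confluent: whenever $v\succcurlyeq S(w)$ there is $u\succcurlyeq w$ with $v=S(u)$. Satisfaction, with $S^0(w)=w$, $S^{k+1}(w)=S(S^k(w))$: $w\models p$ iff $p\in V(w)$; $\bot$ never; $\wedge,\vee$ as usual; $w\models\varphi\to\psi$ iff for all $v\succcurlyeq w$, $v\models\varphi$ implies $v\models\psi$; $w\models\bigcirc\varphi$ iff $S(w)\models\varphi$; $w\models\Diamond\varphi$ iff $S^k(w)\models\varphi$ for some $k\ge0$; $w\models\Box\varphi$ iff $S^k(w)\models\varphi$ for all $k\ge 0$. Valid over a class: true at every world of every model in the class. -}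

module Defs where

open import Data.Nat using (ℕ; zero; suc)
open import Data.Empty using (⊥)
open import Data.Product using (Σ; _×_; _,_; ∃-syntax)
open import Data.Sum using (_⊎_)
open import Relation.Binary.PropositionalEquality using (_≡_)

Atom : Set
Atom = ℕ

data Form : Set where
  var  : Atom → Form
  fls  : Form
  _∧'_ : Form → Form → Form
  _∨'_ : Form → Form → Form
  _⇒_  : Form → Form → Form
  ○_   : Form → Form
  ◇_   : Form → Form
  □_   : Form → Form

infixr 4 _⇒_
infixr 5 _∨'_
infixr 6 _∧'_
infix 7 ○_ ◇_ □_ ¬'_

¬'_ : Form → Form
¬' φ = φ ⇒ fls

record Model : Set₁ where
  field
    W       : Set
    _≼_     : W → W → Set
    ≼-refl  : ∀ w → w ≼ w
    ≼-trans : ∀ {u v w} → u ≼ v → v ≼ w → u ≼ w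
    ≼-antisym : ∀ {u v} → u ≼ v → v ≼ u → u ≡ v
    S       : W → W
    S-fwd   : ∀ {w v} → w ≼ v → S w ≼ S v
    V       : W → Atom → Set
    V-mono  : ∀ {w v} → w ≼ v → ∀ p → V w p → V v p

  iter : ℕ → W → W
  iter zero w = w
  iter (suc k) w = S (iter k w)

Persistent : Model → Set
Persistent M = ∀ w v → S w ≼ v → ∃[ u ] (w ≼ u × v ≡ S u)
  where open Model M

_,_⊨_ : (M : Model) → Model.W M → Form → Set
M , w ⊨ var p = Model.V M w p
M , w ⊨ fls = ⊥
M , w ⊨ (φ ∧' ψ) = (M , w ⊨ φ) × (M , w ⊨ ψ)
M , w ⊨ (φ ∨' ψ) = (M , w ⊨ φ) ⊎ (M , w ⊨ ψ)
M , w ⊨ (φ ⇒ ψ) = ∀ v → Model._≼_ M w v → M , v ⊨ φ → M , v ⊨ ψ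
M , w ⊨ (○ φ) = M , Model.S M w ⊨ φ
M , w ⊨ (◇ φ) = Σ ℕ (λ k → M , Model.iter M k w ⊨ φ)
M , w ⊨ (□ φ) = ∀ k → M , Model.iter M k w ⊨ φ

infix 3 _,_⊨_

ValidPersistent : Form → Set₁
ValidPersistent φ = ∀ (M : Model) → Persistent M → ∀ w → M , w ⊨ φ

module Submission where

-- The model is a "comb": a trunk of worlds trunk t (t ∈ ℕ, time t) on which
-- p never holds, and for every n a branch of worlds branch n t, where p holds
-- exactly from time n on.  Each trunk world trunk t sits below all branch
-- worlds branch n t of the same time, and S advances time by one step.
-- Moving along S commutes with choosing a branch, which gives persistence.
--
-- Two general facts about double negation in any model drive the argument:
-- ¬¬ψ holds at w iff every extension of w has a further extension forcing ψ.
-- At trunk 0 every extension reaches a branch, and every branch satisfies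
-- ◇□p, so the antecedent ¬¬◇□p holds.  But no trunk world satisfies ¬¬□p,
-- since branch (1 + t) t has no extension but itself, and p fails there now.
-- As S^k (trunk 0) = trunk k, the consequent ◇¬¬□p fails at trunk 0.

open import Defs
open import Relation.Nullary using (¬_)
open import Data.Nat using (ℕ; zero; suc; _+_; _≤_)
open import Data.Nat.Properties using (≤-trans; m≤m+n; m≤n+m; n≮n)
open import Data.Empty using (⊥)
open import Data.Product using (_×_; _,_; ∃-syntax)
open import Relation.Binary.PropositionalEquality using (_≡_; refl; sym; cong; subst)

module _ (M : Model) where
  open Model M

  ¬¬-intro-cofinal : ∀ {w} ψ → (∀ v → w ≼ v → ∃[ u ] (v ≼ u × M , u ⊨ ψ)) →
                     M , w ⊨ ¬' ¬' ψ
  ¬¬-intro-cofinal ψ cofinal v w≼v ¬ψ with cofinal v w≼v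
  ... | u , v≼u , ψ-at-u = ¬ψ u v≼u ψ-at-u

  ¬¬-refute : ∀ {w} ψ v → w ≼ v → (∀ u → v ≼ u → ¬ (M , u ⊨ ψ)) →
              ¬ (M , w ⊨ ¬' ¬' ψ)
  ¬¬-refute ψ v w≼v no-ψ ¬¬ψ = ¬¬ψ v w≼v no-ψ

data World : Set where
  trunk  : (t : ℕ) → World
  branch : (n t : ℕ) → World

data _≼_ : World → World → Set where
  stay   : ∀ {w} → w ≼ w
  commit : ∀ {n t} → trunk t ≼ branch n t

≼-trans : ∀ {u v w} → u ≼ v → v ≼ w → u ≼ w
≼-trans stay   v≼w  = v≼w
≼-trans commit stay = commit

≼-antisym : ∀ {u v} → u ≼ v → v ≼ u → u ≡ v
≼-antisym stay _ = refl

step : World → World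
step (trunk t)    = trunk (suc t)
step (branch n t) = branch n (suc t)

step-fwd : ∀ {w v} → w ≼ v → step w ≼ step v
step-fwd stay   = stay
step-fwd commit = commit

val : World → Atom → Set
val (trunk t)    _ = ⊥
val (branch n t) _ = n ≤ t

val-mono : ∀ {w v} → w ≼ v → ∀ p → val w p → val v p
val-mono stay _ holds = holds

comb : Model
comb = record
  { W = World ; _≼_ = _≼_ ; ≼-refl = λ _ → stay ; ≼-trans = ≼-trans
  ; ≼-antisym = ≼-antisym ; S = step ; S-fwd = step-fwd
  ; V = val ; V-mono = val-mono }

comb-persistent : Persistent comb
comb-persistent (trunk t)    _ stay   = trunk t , stay , refl
comb-persistent (trunk t)    _ commit = branch _ t , commit , refl
comb-persistent (branch n t) _ stay   = branch n t , stay , refl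

open Model comb using (iter)

iter-trunk : ∀ k t → iter k (trunk t) ≡ trunk (k + t)
iter-trunk zero    t = refl
iter-trunk (suc k) t = cong step (iter-trunk k t)

iter-branch : ∀ k n t → iter k (branch n t) ≡ branch n (k + t)
iter-branch zero    n t = refl
iter-branch (suc k) n t = cong step (iter-branch k n t)

p : Form
p = var 0

branch-□p : ∀ {n t} → n ≤ t → comb , branch n t ⊨ □ p
branch-□p {n} {t} n≤t k =
  subst (λ w → comb , w ⊨ p) (sym (iter-branch k n t)) (≤-trans n≤t (m≤n+m t k))

branch-◇□p : ∀ n t → comb , branch n t ⊨ ◇ □ p
branch-◇□p n t = n , subst (λ w → comb , w ⊨ □ p) (sym (iter-branch n n t)) (branch-□p (m≤m+n n t))

-- The antecedent holds at the root: every extension of trunk 0 extends to a branch.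
root-¬¬◇□p : comb , trunk 0 ⊨ ¬' ¬' ◇ □ p
root-¬¬◇□p = ¬¬-intro-cofinal comb (◇ □ p) reach-branch
  where
  reach-branch : ∀ v → trunk 0 ≼ v → ∃[ u ] (v ≼ u × comb , u ⊨ ◇ □ p)
  reach-branch _ stay   = branch 0 0 , commit , branch-◇□p 0 0
  reach-branch _ commit = _ , stay , branch-◇□p _ 0

-- No trunk world forces ¬¬□p: the branch starting after time t is a dead end.
trunk-not-¬¬□p : ∀ t → ¬ (comb , trunk t ⊨ ¬' ¬' □ p)
trunk-not-¬¬□p t = ¬¬-refute comb (□ p) (branch (suc t) t) commit p-fails-now
  where
  p-fails-now : ∀ u → branch (suc t) t ≼ u → ¬ (comb , u ⊨ □ p)
  p-fails-now _ stay □p = n≮n t (□p 0)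

lemma10 : ¬ ValidPersistent (¬' ¬' ◇ □ var 0 ⇒ ◇ ¬' ¬' □ var 0)
lemma10 valid with valid comb comb-persistent (trunk 0) (trunk 0) stay root-¬¬◇□p
... | k , ¬¬□p-at-k =
  trunk-not-¬¬□p (k + 0) (subst (λ w → comb , w ⊨ ¬' ¬' □ p) (iter-trunk k 0) ¬¬□p-at-k)
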